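{- Assume the setting described in the context, and let $S,T\in\mathcal{B}(c_s')$. \begin{enumerate} \item If $S\neq T$, then $\Delta(S)\cap\Delta(T)=\emptyset$. \item Let $x\in\Delta(S)$, $y\in\Delta(T)$, and let $g\in G_\alpha$ with $y=x^g$. Then $\Delta(S)^g=\Delta(T)$, and $g$ induces a bijection from $S$ to $T$ (namely $j\mapsto h$ where $\beta_j^g=\beta_h$). \end{enumerate}
   Context: Graphs are finite, simple, connected, undirected. For a vertex $v$, $\Gamma_i(v)$ is the set of vertices at distance $i$ from $v$. The $v$-girth $\lambda_v(\Gamma)$ is the length of a shortest cycle through $v$; the local girth at $\alpha$ is $\lambda(\Gamma,\alpha)=\min(\{\lambda_\alpha(\Gamma)\}\cup\{\lambda_\beta(\Gamma)+1\mid\beta\in\Gamma_1(\alpha)\})$. A group acting on a set $Y$ is $t$-homogeneous if it is transitive on the $t$-subsets of $Y$. Setting: $\Gamma$ is a $k$-regular graph with $k\geqslant 3$, $G\leqslant\mathrm{Aut}(\Gamma)$, $\alpha\in V\Gamma$, $s\geqslant1$ with $\lambda(\Gamma,\alpha)\geqslant 2s+2$, $G_\alpha$ is transitive on $\Gamma_s(\alpha)$, and $\Delta$ is a $G_\alpha$-orbit contained in $\Gamma_{s+1}(\alpha)$. Let $c_s'=|\Gamma_1(\delta)\cap\Gamma_s(\alpha)|$ for $\delta\in\Delta$ (independent of $\delta$). Assume the action of $G_\alpha$ on $\Gamma_1(\alpha)$ is $t$-homogeneous for some integer $1\leqslant t\leqslant c_s'$. Write $\Gamma_1(\alpha)=\{\beta_1,\ldots,\beta_k\}$,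 $X=\{1,\ldots,k\}$. For $S\subseteq X$ let $\Delta(S)=\Delta\cap\bigcap_{j\in S}\Gamma_s(\beta_j)$, and let $\mathcal{B}(c_s')=\{S\subseteq X\mid |S|=c_s',\ \Delta(S)\neq\emptyset\}$. -}

module Defs where

open import Level using (0ℓ)
open import Data.Nat using (ℕ; zero; suc; _+_; _*_; _≤_; _<_; _∸_)
open import Data.Bool using (Bool; true; false; if_then_else_)
open import Data.Fin using (Fin; zero; suc; inject₁; fromℕ)
open import Data.Fin.Subset using (Subset; _∈_; ∣_∣)
open import Data.List using (List; map; allFin)
open import Data.Nat.ListAction using (sum)
open import Data.Product using (Σ; ∃; _×_; _,_)
open import Relation.Binary.PropositionalEquality using (_≡_; _≢_)
open import Relation.Nullary using (¬_)
open import Function.Bundles using (_⇔_)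
open import Function.Definitions using (Injective)

record Graph (n : ℕ) : Set where
  field
    adj     : Fin n → Fin n → Bool
    sym     : ∀ u v → adj u v ≡ adj v u
    irrefl  : ∀ u → adj u u ≡ false

module _ {n : ℕ} (Γ : Graph n) where
  open Graph Γ

  Adj : Fin n → Fin n → Set
  Adj u v = adj u v ≡ true

  data Walk : Fin n → Fin n → ℕ → Set where
    here : ∀ {u} → Walk u u 0
    step : ∀ {u w v m} → Adj u w → Walk w v m → Walk u v (suc m)

  Connected : Set
  Connected = ∀ u v → ∃ λ m → Walk u v m

  Dist : Fin n → Fin n → ℕ → Set
  Dist u v i = Walk u v i × (∀ j → j < i → ¬ Walk u v j)

  degree : Fin n → ℕ
  degree u = sum (map (λ w → if adj u w then 1 else 0) (allFin n))

  Regular : ℕ → Set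
  Regular k = ∀ u → degree u ≡ k

  record CycleThrough (v : Fin n) (m : ℕ) : Set where
    field
      l        : ℕ
      len      : m ≡ suc l
      long     : 2 ≤ l
      c        : Fin (suc l) → Fin n
      inj      : Injective _≡_ _≡_ c
      start    : c zero ≡ v
      adjacent : ∀ (i : Fin l) → Adj (c (inject₁ i)) (c (suc i))
      closing  : Adj (c (fromℕ l)) (c zero)

  -- λ_v(Γ) ≥ L  (with min ∅ = ∞)
  VGirth≥ : Fin n → ℕ → Set
  VGirth≥ v L = ∀ m → CycleThrough v m → L ≤ m

  -- local girth λ(Γ,α) ≥ L, unfolding the minimum in the definition
  LocalGirth≥ : Fin n → ℕ → Set
  LocalGirth≥ α L = VGirth≥ α L × (∀ β → Adj α β → VGirth≥ β L' )
    where L' = L ∸ 1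

record Perm (n : ℕ) : Set where
  field
    to      : Fin n → Fin n
    from    : Fin n → Fin n
    to∘from : ∀ x → to (from x) ≡ x
    from∘to : ∀ x → from (to x) ≡ x
open Perm public

idPerm : ∀ {n} → Perm n
idPerm = record { to = λ x → x ; from = λ x → x
                ; to∘from = λ _ → Relation.Binary.PropositionalEquality.refl
                ; from∘to = λ _ → Relation.Binary.PropositionalEquality.refl }

-- apply g, then h  (x ^ (g h) = (x ^ g) ^ h)
_·_ : ∀ {n} → Perm n → Perm n → Perm n
g · h = record
  { to = λ x → to h (to g x) ; from = λ x → from g (from h x)
  ; to∘from = λ x → Relation.Binary.PropositionalEquality.trans
      (Relation.Binary.PropositionalEquality.cong (to h) (to∘from g (from h x))) (to∘from h x)
  ; from∘to = λ x → Relation.Binary.PropositionalEquality.trans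
      (Relation.Binary.PropositionalEquality.cong (from g) (from∘to h (to g x))) (from∘to g x) }

_⁻¹ : ∀ {n} → Perm n → Perm n
g ⁻¹ = record { to = from g ; from = to g ; to∘from = from∘to g ; from∘to = to∘from g }

IsAut : ∀ {n} → Graph n → Perm n → Set
IsAut Γ g = ∀ u v → Graph.adj Γ (to g u) (to g v) ≡ Graph.adj Γ u v

-- G ≤ Aut(Γ), given as a predicate on permutations closed under the group operations
record AutSubgroup {n : ℕ} (Γ : Graph n) : Set₁ where
  field
    InG  : Perm n → Set
    aut  : ∀ g → InG g → IsAut Γ g
    id∈  : InG idPerm
    ·∈   : ∀ g h → InG g → InG h → InG (g · h)
    ⁻¹∈  : ∀ g → InG g → InG (g ⁻¹)

HasSize : ∀ {n} → (Fin n → Set) → ℕ → Set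
HasSize {n} P m = Σ (Subset n) λ A → (∀ x → (x ∈ A) ⇔ P x) × ∣ A ∣ ≡ m

-- The standing setting of the paper.
-- Γ_1(α) = {β_j | j ∈ Fin k};  X = Fin k;
-- Δ = the G_α-orbit of δ₀ ∈ Γ_{s+1}(α);  c = c_s'.

record Setting (n k s t c : ℕ) : Set₁ where
  field
    Γ          : Graph n
    connected  : Connected Γ
    k≥3        : 3 ≤ k
    regular    : Regular Γ k
    G          : AutSubgroup Γ
    α          : Fin n
    s≥1        : 1 ≤ s
    girth      : LocalGirth≥ Γ α (2 * s + 2)
    transitive : ∀ x y → Dist Γ α x s → Dist Γ α y s →
                 ∃ λ g → (AutSubgroup.InG G g × to g α ≡ α) × to g x ≡ y
    δ₀         : Fin n
    δ₀-dist    : Dist Γ α δ₀ (suc s)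
    β          : Fin k → Fin n
    β-inj      : Injective _≡_ _≡_ β
    β-nbr      : ∀ w → Adj Γ α w ⇔ (∃ λ j → β j ≡ w)
    c-def      : ∀ δ → (∃ λ g → (AutSubgroup.InG G g × to g α ≡ α) × to g δ₀ ≡ δ) →
                 HasSize (λ w → Adj Γ δ w × Dist Γ α w s) c
    -- G_α is t-homogeneous on Γ_1(α), 1 ≤ t ≤ c_s'
    1≤t        : 1 ≤ t
    t≤c        : t ≤ c
    homog      : ∀ (A B : Subset k) → ∣ A ∣ ≡ t → ∣ B ∣ ≡ t →
                 ∃ λ g → (AutSubgroup.InG G g × to g α ≡ α) ×
                   (∀ h → (h ∈ B) ⇔ (∃ λ j → j ∈ A × to g (β j) ≡ β h))

module _ {n k s t c : ℕ} (σ : Setting n k s t c) where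
  open Setting σ

  InStab : Perm n → Set
  InStab g = AutSubgroup.InG G g × to g α ≡ α

  InΔ : Fin n → Set
  InΔ x = ∃ λ g → InStab g × to g δ₀ ≡ x

  InΔS : Subset k → Fin n → Set
  InΔS S x = InΔ x × (∀ j → j ∈ S → Dist Γ (β j) x s)

  InB : Subset k → Set
  InB S = ∣ S ∣ ≡ c × ∃ λ x → InΔS S x

module Submission where

-- The geometric heart is a girth argument: two shortest walks α → w of length L whose
-- second vertices differ close up, at their first common vertex, into a cycle through α
-- of length at most 2L.  Since λ_α(Γ) ≥ 2s+2, all shortest walks of length s from α to a
-- given vertex leave α along the same edge.
--
-- Consequently, for x ∈ Δ ⊆ Γ_{s+1}(α), each j with d(β_j, x) = s has a "foot": the
-- neighbour of x on the geodesic α β_j … x, which lies in Γ_1(x) ∩ Γ_s(α); distinct j give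
-- distinct feet.  Hence at most c = c_s' indices j satisfy d(β_j, x) = s, so a c-set S with
-- x ∈ Δ(S) is exactly {j | d(β_j, x) = s}: the vertex x determines S.  Part (1) follows at
-- once, and part (2) follows because g ∈ G_α permutes Γ_1(α) and preserves distances.

open import Defs
open import Data.Nat using (ℕ; zero; suc; _+_; _*_; _∸_; _≤_; _<_; z≤n; s≤s; _≤?_)
open import Data.Nat.Properties
  using (≤-refl; ≤-trans; n≤1+n; <⇒≤; <⇒≱; ≰⇒>; <-cmp; m<n⇒m<1+n; m<1+n⇒m<n∨m≡n;
         +-∸-assoc; n∸n≡0; m+[n∸m]≡n; ∸-cancelˡ-≡; ∸-monoʳ-<; m∸n≤m; m<n⇒0<n∸m;
         +-cancelˡ-<; +-monoˡ-<; +-monoˡ-≤; +-mono-≤; +-identityʳ; m<m+n)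
open import Data.Fin using (Fin; toℕ) renaming (zero to fzero; suc to fsuc)
open import Data.Fin.Properties
  using (toℕ-injective; toℕ<n; toℕ-inject₁; toℕ-fromℕ; 0≢1+n; suc-injective)
  renaming (_≟_ to _≟ᶠ_)
open import Data.Fin.Subset using (Subset; _∈_; ∣_∣; _∪_; ⁅_⁆; _-_)
open import Data.Fin.Subset.Properties
  using (_∈?_; ⊆-antisym; p⊂q⇒∣p∣<∣q∣; p⊆p∪q; x∈p∪q⁺; x∈p∪q⁻; x∈⁅x⁆; x∈⁅y⁆⇒x≡y;
         x∈p⇒∣p-x∣<∣p∣; x∈p∧x≢y⇒x∈p-y)
open import Data.Vec.Base using (_∷_; []; here; there)
open import Data.Bool using (true; false)
open import Data.Product using (Σ; ∃; _×_; _,_; proj₁; proj₂)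
open import Data.Sum using (inj₁; inj₂)
open import Data.Empty using (⊥-elim)
open import Relation.Binary.PropositionalEquality
open import Relation.Binary.Definitions using (tri<; tri≈; tri>)
open import Relation.Nullary using (¬_; Dec; yes; no)
open import Function.Bundles using (_⇔_; Equivalence; mk⇔)

least : (P : ℕ → Set) → (∀ a → Dec (P a)) → ∀ N → P N →
        ∃ λ m → P m × m ≤ N × (∀ a → a < m → ¬ P a)
least P P? zero p = 0 , p , z≤n , λ _ ()
least P P? (suc N) p with P? 0
... | yes p0 = 0 , p0 , z≤n , λ _ ()
... | no ¬p0 with least (λ a → P (suc a)) (λ a → P? (suc a)) N p
...   | m , pm , m≤N , below = suc m , pm , s≤s m≤N , minimal
  where
  minimal : ∀ a → a < suc m → ¬ P a
  minimal zero _ = ¬p0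
  minimal (suc a) (s≤s a<m) = below a a<m

injection-size : ∀ {k m} (B : Subset k) (A : Subset m) (f : ∀ j → j ∈ B → Fin m) →
                 (∀ j p → f j p ∈ A) → (∀ i j p q → f i p ≡ f j q → i ≡ j) → ∣ B ∣ ≤ ∣ A ∣
injection-size [] A f into injective = z≤n
injection-size (false ∷ B) A f into injective =
  injection-size B A (λ j p → f (fsuc j) (there p)) (λ j p → into (fsuc j) (there p))
    (λ i j p q e → suc-injective (injective (fsuc i) (fsuc j) (there p) (there q) e))
injection-size {m = m} (true ∷ B) A f into injective =
  ≤-trans (s≤s (injection-size B (A - a) f′ into′ injective′)) (x∈p⇒∣p-x∣<∣p∣ (into fzero here))
  where
  -- the image of the first element is removed from A; the rest maps into A - a
  a : Fin m
  a = f fzero here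
  f′ : ∀ j → j ∈ B → Fin m
  f′ j p = f (fsuc j) (there p)
  into′ : ∀ j p → f′ j p ∈ A - a
  into′ j p = x∈p∧x≢y⇒x∈p-y (into (fsuc j) (there p))
                (λ e → 0≢1+n (injective fzero (fsuc j) here (there p) (sym e)))
  injective′ : ∀ i j p q → f′ i p ≡ f′ j q → i ≡ j
  injective′ i j p q e = suc-injective (injective (fsuc i) (fsuc j) (there p) (there q) e)

module Walks {n : ℕ} (Γ : Graph n) where

  adj-sym : ∀ {u v} → Adj Γ u v → Adj Γ v u
  adj-sym {u} {v} e = trans (Graph.sym Γ v u) e

  _++_ : ∀ {u v w a b} → Walk Γ u v a → Walk Γ v w b → Walk Γ u w (a + b)
  here ++ q = q
  step e p ++ q = step e (p ++ q)

  snoc : ∀ {u v w m} → Walk Γ u v m → Adj Γ v w → Walk Γ u w (suc m)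
  snoc here e = step e here
  snoc (step e′ p) e = step e′ (snoc p e)

  reverse : ∀ {u v m} → Walk Γ u v m → Walk Γ v u m
  reverse here = here
  reverse (step e p) = snoc (reverse p) (adj-sym e)

  -- the i-th vertex of a walk (its endpoint when i exceeds the length)
  vertex : ∀ {u v m} → Walk Γ u v m → ℕ → Fin n
  vertex {u} here i = u
  vertex {u} (step e p) zero = u
  vertex (step e p) (suc i) = vertex p i

  vertex-start : ∀ {u v m} (p : Walk Γ u v m) → vertex p 0 ≡ u
  vertex-start here = refl
  vertex-start (step e p) = refl

  vertex-end : ∀ {u v m} (p : Walk Γ u v m) → vertex p m ≡ v
  vertex-end here = refl
  vertex-end (step e p) = vertex-end p

  vertex-adj : ∀ {u v m} (p : Walk Γ u v m) i → i < m → Adj Γ (vertex p i) (vertex p (suc i))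
  vertex-adj (step e p) zero _ = subst (Adj Γ _) (sym (vertex-start p)) e
  vertex-adj (step e p) (suc i) (s≤s i<m) = vertex-adj p i i<m

  prefix : ∀ {u v m} (p : Walk Γ u v m) i → i ≤ m → Walk Γ u (vertex p i) i
  prefix here zero _ = here
  prefix (step e p) zero _ = here
  prefix (step e p) (suc i) (s≤s i≤m) = step e (prefix p i i≤m)

  suffix : ∀ {u v m} (p : Walk Γ u v m) i → i ≤ m → Walk Γ (vertex p i) v (m ∸ i)
  suffix here zero _ = here
  suffix (step e p) zero _ = step e p
  suffix (step e p) (suc i) (s≤s i≤m) = suffix p i i≤m

  vertex-prefix : ∀ {u v m} (p : Walk Γ u v m) i (i≤m : i ≤ m) j → j ≤ i →
                  vertex (prefix p i i≤m) j ≡ vertex p j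
  vertex-prefix here zero _ zero _ = refl
  vertex-prefix (step e p) zero _ zero _ = refl
  vertex-prefix (step e p) (suc i) (s≤s _) zero _ = refl
  vertex-prefix (step e p) (suc i) (s≤s i≤m) (suc j) (s≤s j≤i) = vertex-prefix p i i≤m j j≤i

  vertex-++ˡ : ∀ {u v w a b} (p : Walk Γ u v a) (q : Walk Γ v w b) i → i ≤ a →
               vertex (p ++ q) i ≡ vertex p i
  vertex-++ˡ here q zero _ = vertex-start q
  vertex-++ˡ (step e p) q zero _ = refl
  vertex-++ˡ (step e p) q (suc i) (s≤s i≤a) = vertex-++ˡ p q i i≤a

  vertex-++ʳ : ∀ {u v w a b} (p : Walk Γ u v a) (q : Walk Γ v w b) i →
               vertex (p ++ q) (a + i) ≡ vertex q i
  vertex-++ʳ here q i = refl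
  vertex-++ʳ (step e p) q i = vertex-++ʳ p q i

  vertex-snoc : ∀ {u v w m} (p : Walk Γ u v m) (e : Adj Γ v w) i → i ≤ m →
                vertex (snoc p e) i ≡ vertex p i
  vertex-snoc here e zero _ = refl
  vertex-snoc (step e′ p) e zero _ = refl
  vertex-snoc (step e′ p) e (suc i) (s≤s i≤m) = vertex-snoc p e i i≤m

  vertex-reverse : ∀ {u v m} (p : Walk Γ u v m) i → i ≤ m → vertex (reverse p) i ≡ vertex p (m ∸ i)
  vertex-reverse here zero _ = refl
  vertex-reverse {m = suc m} (step e p) i i≤1+m with m<1+n⇒m<n∨m≡n (s≤s i≤1+m)
  ... | inj₁ (s≤s i≤m) = begin
    vertex (snoc (reverse p) (adj-sym e)) i  ≡⟨ vertex-snoc (reverse p) (adj-sym e) i i≤m ⟩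
    vertex (reverse p) i                     ≡⟨ vertex-reverse p i i≤m ⟩
    vertex p (m ∸ i)                         ≡⟨ cong (vertex (step e p)) (sym (+-∸-assoc 1 i≤m)) ⟩
    vertex (step e p) (suc m ∸ i)            ∎
    where open ≡-Reasoning
  ... | inj₂ refl = trans (vertex-end (snoc (reverse p) (adj-sym e)))
                          (cong (vertex (step e p)) (sym (n∸n≡0 (suc m))))

  Shortest : Fin n → Fin n → ℕ → Set
  Shortest u v m = ∀ j → j < m → ¬ Walk Γ u v j

  dist-unique : ∀ {u v a b} → Dist Γ u v a → Dist Γ u v b → a ≡ b
  dist-unique {a = a} {b} (p , shortest-p) (q , shortest-q) with <-cmp a b
  ... | tri< a<b _ _ = ⊥-elim (shortest-q a a<b p)
  ... | tri≈ _ a≡b _ = a≡b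
  ... | tri> _ _ b<a = ⊥-elim (shortest-p b b<a q)

  geodesic-levels : ∀ {u v m} → Shortest u v m → (p : Walk Γ u v m) →
                    ∀ i → i ≤ m → Dist Γ u (vertex p i) i
  geodesic-levels {m = m} shortest p i i≤m = prefix p i i≤m , λ j j<i q →
    shortest (j + (m ∸ i)) (subst (j + (m ∸ i) <_) (m+[n∸m]≡n i≤m) (+-monoˡ-< (m ∸ i) j<i))
             (q ++ suffix p i i≤m)

  map-walk : (g : Perm n) → IsAut Γ g → ∀ {u v m} → Walk Γ u v m → Walk Γ (to g u) (to g v) m
  map-walk g aut here = here
  map-walk g aut (step {u} {w} e p) = step (trans (aut u w) e) (map-walk g aut p)

  inverse-aut : (g : Perm n) → IsAut Γ g → IsAut Γ (g ⁻¹)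
  inverse-aut g aut u v = trans (sym (aut (from g u) (from g v)))
                                (cong₂ (Graph.adj Γ) (to∘from g u) (to∘from g v))

  map-dist : (g : Perm n) → IsAut Γ g → ∀ {u v i} → Dist Γ u v i → Dist Γ (to g u) (to g v) i
  map-dist g aut {u} {v} (p , shortest) = map-walk g aut p , λ j j<i q → shortest j j<i
    (subst₂ (λ x y → Walk Γ x y j) (from∘to g u) (from∘to g v) (map-walk (g ⁻¹) (inverse-aut g aut) q))

module Cycles {n : ℕ} (Γ : Graph n) where
  open Walks Γ

  closed-walk-cycle : ∀ {α m} (C : Walk Γ α α m) → 3 ≤ m →
                      (∀ i j → i < m → j < m → vertex C i ≡ vertex C j → i ≡ j) → CycleThrough Γ α m
  closed-walk-cycle {m = suc l} C (s≤s 2≤l) distinct = record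
    { l = l ; len = refl ; long = 2≤l
    ; c = λ i → vertex C (toℕ i)
    ; inj = λ {i} {j} e → toℕ-injective (distinct (toℕ i) (toℕ j) (toℕ<n i) (toℕ<n j) e)
    ; start = vertex-start C
    ; adjacent = λ i → subst (λ a → Adj Γ (vertex C a) (vertex C (suc (toℕ i)))) (sym (toℕ-inject₁ i))
                             (vertex-adj C (toℕ i) (m<n⇒m<1+n (toℕ<n i)))
    ; closing = subst₂ (Adj Γ) (cong (vertex C) (sym (toℕ-fromℕ l)))
                       (trans (vertex-end C) (sym (vertex-start C))) (vertex-adj C l ≤-refl)
    }

  -- positions on a closed walk of length M + M: the outward half, then the return half
  data Position (M : ℕ) : ℕ → Set where
    outward : ∀ i → i ≤ M → Position M i
    inward  : ∀ r → 1 ≤ r → r < M → Position M (M + r)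

  position : ∀ M i → i < M + M → Position M i
  position M i i<M+M with i ≤? M
  ... | yes i≤M = outward i i≤M
  ... | no i≰M = subst (Position M) M+r≡i (inward (i ∸ M) (m<n⇒0<n∸m M<i) r<M)
    where
    M<i : M < i
    M<i = ≰⇒> i≰M
    M+r≡i : M + (i ∸ M) ≡ i
    M+r≡i = m+[n∸m]≡n (<⇒≤ M<i)
    r<M : i ∸ M < M
    r<M = +-cancelˡ-< M (i ∸ M) M (subst (_< M + M) (sym M+r≡i) i<M+M)

  apart-geodesics-cycle : ∀ {α w w′ M} → Shortest α w M → (P : Walk Γ α w M) (Q : Walk Γ α w′ M) →
                          w ≡ w′ → 2 ≤ M → (∀ i → 1 ≤ i → i < M → vertex P i ≢ vertex Q i) →
                          CycleThrough Γ α (M + M)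
  apart-geodesics-cycle {α} {M = M} shortest P Q refl 2≤M apart =
    closed-walk-cycle C (≤-trans (s≤s 2≤M) (+-monoˡ-≤ M (≤-trans (s≤s z≤n) 2≤M))) distinct
    where
    C : Walk Γ α α (M + M)
    C = P ++ reverse Q

    on-P : ∀ i → i ≤ M → vertex C i ≡ vertex P i
    on-P = vertex-++ˡ P (reverse Q)

    on-Q : ∀ r → r ≤ M → vertex C (M + r) ≡ vertex Q (M ∸ r)
    on-Q r r≤M = trans (vertex-++ʳ P (reverse Q) r) (vertex-reverse Q r r≤M)

    same-level : ∀ {x y i j} → Dist Γ α x i → Dist Γ α y j → x ≡ y → i ≡ j
    same-level dx dy refl = dist-unique dx dy

    crossing : ∀ i r → i ≤ M → 1 ≤ r → r < M → vertex P i ≢ vertex Q (M ∸ r)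
    crossing i r i≤M 1≤r r<M e = apart (M ∸ r) (m<n⇒0<n∸m r<M) (∸-monoʳ-< 1≤r (<⇒≤ r<M))
      (subst (λ a → vertex P a ≡ vertex Q (M ∸ r)) i≡M∸r e)
      where
      i≡M∸r : i ≡ M ∸ r
      i≡M∸r = same-level (geodesic-levels shortest P i i≤M)
                         (geodesic-levels shortest Q (M ∸ r) (m∸n≤m M r)) e

    distinct : ∀ i j → i < M + M → j < M + M → vertex C i ≡ vertex C j → i ≡ j
    distinct i j i< j< e with position M i i< | position M j j<
    ... | outward i i≤M | outward j j≤M =
      same-level (geodesic-levels shortest P i i≤M) (geodesic-levels shortest P j j≤M)
                 (trans (sym (on-P i i≤M)) (trans e (on-P j j≤M)))
    ... | outward i i≤M | inward r 1≤r r<M =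
      ⊥-elim (crossing i r i≤M 1≤r r<M (trans (sym (on-P i i≤M)) (trans e (on-Q r (<⇒≤ r<M)))))
    ... | inward r 1≤r r<M | outward j j≤M =
      ⊥-elim (crossing j r j≤M 1≤r r<M (trans (sym (on-P j j≤M)) (trans (sym e) (on-Q r (<⇒≤ r<M)))))
    ... | inward r _ r<M | inward r′ _ r′<M = cong (M +_) (∸-cancelˡ-≡ (<⇒≤ r<M) (<⇒≤ r′<M)
      (same-level (geodesic-levels shortest Q (M ∸ r) (m∸n≤m M r))
                  (geodesic-levels shortest Q (M ∸ r′) (m∸n≤m M r′))
                  (trans (sym (on-Q r (<⇒≤ r<M))) (trans e (on-Q r′ (<⇒≤ r′<M))))))

  -- Two shortest walks α → w of length L leaving α along different edges yield a cycle
  -- through α of length at most L + L: cut both at their first common vertex after α.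
  branching-geodesics-cycle : ∀ {α w L} → Shortest α w L → (P Q : Walk Γ α w L) →
                              vertex P 1 ≢ vertex Q 1 → ∃ λ m → m ≤ L + L × CycleThrough Γ α m
  branching-geodesics-cycle {L = zero} shortest here here differ = ⊥-elim (differ refl)
  branching-geodesics-cycle {L = suc L′} shortest P Q differ
    with least (λ a → vertex P (suc a) ≡ vertex Q (suc a)) (λ a → vertex P (suc a) ≟ᶠ vertex Q (suc a))
               L′ (trans (vertex-end P) (sym (vertex-end Q)))
  ... | zero , meet , _ , _ = ⊥-elim (differ meet)
  ... | suc a , meet , a≤L′ , before =
    M + M , +-mono-≤ M≤L M≤L ,
    apart-geodesics-cycle (proj₂ (geodesic-levels shortest P M M≤L))
      (prefix P M M≤L) (prefix Q M M≤L) meet (s≤s (s≤s z≤n)) apart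
    where
    M : ℕ
    M = suc (suc a)
    M≤L : M ≤ suc L′
    M≤L = s≤s a≤L′
    apart : ∀ i → 1 ≤ i → i < M → vertex (prefix P M M≤L) i ≢ vertex (prefix Q M M≤L) i
    apart (suc b) _ (s≤s b<M-1) e = before b b<M-1
      (trans (sym (vertex-prefix P M M≤L (suc b) (<⇒≤ (s≤s b<M-1))))
             (trans e (vertex-prefix Q M M≤L (suc b) (<⇒≤ (s≤s b<M-1)))))

  geodesics-share-first-edge : ∀ {α w w′ L g} → VGirth≥ Γ α g → L + L < g → Shortest α w L →
                               (P : Walk Γ α w L) (Q : Walk Γ α w′ L) → w ≡ w′ → vertex P 1 ≡ vertex Q 1
  geodesics-share-first-edge girth L+L<g shortest P Q refl with vertex P 1 ≟ᶠ vertex Q 1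
  ... | yes same = same
  ... | no differ with branching-geodesics-cycle shortest P Q differ
  ...   | m , m≤L+L , cycle = ⊥-elim (<⇒≱ L+L<g (≤-trans (girth m cycle) m≤L+L))

module InSetting {n k s t c : ℕ} (σ : Setting n k s t c) where
  open Setting σ
  open Walks Γ
  open Cycles Γ

  β-adj : ∀ j → Adj Γ α (β j)
  β-adj j = Equivalence.from (β-nbr (β j)) (j , refl)

  stab-aut : ∀ {g} → InStab σ g → IsAut Γ g
  stab-aut {g} (g∈G , _) = AutSubgroup.aut G g g∈G

  stab-inverse : ∀ {g} → InStab σ g → InStab σ (g ⁻¹)
  stab-inverse {g} (g∈G , gα) =
    AutSubgroup.⁻¹∈ G g g∈G , trans (cong (from g) (sym gα)) (from∘to g α)

  Δ-closed : ∀ {g z} → InStab σ g → InΔ σ z → InΔ σ (to g z)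
  Δ-closed {g} (g∈G , gα) (h , (h∈G , hα) , refl) =
    h · g , (AutSubgroup.·∈ G h g h∈G g∈G , trans (cong (to g) hα) gα) , refl

  -- Δ ⊆ Γ_{s+1}(α), since automorphisms fixing α preserve distances from α
  Δ-dist : ∀ {x} → InΔ σ x → Dist Γ α x (suc s)
  Δ-dist (h , hSt@(_ , hα) , refl) =
    subst (λ a → Dist Γ a (to h δ₀) (suc s)) hα (map-dist h (stab-aut hSt) δ₀-dist)

  -- an element g ∈ G_α permutes Γ_1(α) = {β_j}; `induced g` is the permutation of indices
  image-adj : ∀ g → InStab σ g → ∀ j → Adj Γ α (to g (β j))
  image-adj g gSt@(_ , gα) j =
    subst (λ a → Adj Γ a (to g (β j))) gα (trans (stab-aut gSt α (β j)) (β-adj j))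

  induced : ∀ g → InStab σ g → Fin k → Fin k
  induced g gSt j = proj₁ (Equivalence.to (β-nbr (to g (β j))) (image-adj g gSt j))

  induced-β : ∀ g (gSt : InStab σ g) j → to g (β j) ≡ β (induced g gSt j)
  induced-β g gSt j = sym (proj₂ (Equivalence.to (β-nbr (to g (β j))) (image-adj g gSt j)))

  induced-unique : ∀ g (gSt : InStab σ g) j h → to g (β j) ≡ β h → induced g gSt j ≡ h
  induced-unique g gSt j h e = β-inj (trans (sym (induced-β g gSt j)) e)

  induced-inverse : ∀ g (gSt : InStab σ g) j → induced (g ⁻¹) (stab-inverse gSt) (induced g gSt j) ≡ j
  induced-inverse g gSt j = induced-unique (g ⁻¹) (stab-inverse gSt) _ j
    (trans (cong (from g) (sym (induced-β g gSt j))) (from∘to g (β j)))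

  induced-section : ∀ g (gSt : InStab σ g) h → induced g gSt (induced (g ⁻¹) (stab-inverse gSt) h) ≡ h
  induced-section g gSt h = induced-unique g gSt _ h
    (trans (cong (to g) (sym (induced-β (g ⁻¹) (stab-inverse gSt) h))) (to∘from g (β h)))

  induced-injective : ∀ g (gSt : InStab σ g) i j → induced g gSt i ≡ induced g gSt j → i ≡ j
  induced-injective g gSt i j e = trans (sym (induced-inverse g gSt i))
    (trans (cong (induced (g ⁻¹) (stab-inverse gSt)) e) (induced-inverse g gSt j))

  map-dist-β : ∀ {g z j} (gSt : InStab σ g) → Dist Γ (β j) z s → Dist Γ (β (induced g gSt j)) (to g z) s
  map-dist-β {g} {z} {j} gSt d =
    subst (λ a → Dist Γ a (to g z) s) (induced-β g gSt j) (map-dist g (stab-aut gSt) d)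

  -- For x ∈ Γ_{s+1}(α) with d(β_j, x) = s, the walk α β_j … x is a geodesic; its
  -- vertex before x is the foot of j, a neighbour of x in Γ_s(α).
  through : ∀ {x} j → Dist Γ (β j) x s → Walk Γ α x (suc s)
  through j d = step (β-adj j) (proj₁ d)

  foot : ∀ {x} j → Dist Γ (β j) x s → Fin n
  foot j d = vertex (through j d) s

  foot-adj : ∀ {x} j (d : Dist Γ (β j) x s) → Adj Γ x (foot j d)
  foot-adj j d = adj-sym (subst (Adj Γ (foot j d)) (vertex-end (through j d))
                                (vertex-adj (through j d) s ≤-refl))

  foot-level : ∀ {x} → Dist Γ α x (suc s) → ∀ j (d : Dist Γ (β j) x s) → Dist Γ α (foot j d) s
  foot-level dx j d = geodesic-levels (proj₂ dx) (through j d) s (n≤1+n s)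

  -- distinct indices have distinct feet: otherwise two geodesics of length s to the
  -- common foot would leave α along different edges, against λ_α(Γ) ≥ 2s + 2
  foot-injective : ∀ {x} → Dist Γ α x (suc s) → ∀ i j (di : Dist Γ (β i) x s) (dj : Dist Γ (β j) x s) →
                   foot i di ≡ foot j dj → i ≡ j
  foot-injective dx i j di dj e = β-inj (begin
    β i                                          ≡⟨ sym (vertex-start (proj₁ di)) ⟩
    vertex (through i di) 1                      ≡⟨ sym (vertex-prefix (through i di) s s≤1+s 1 s≥1) ⟩
    vertex (prefix (through i di) s s≤1+s) 1     ≡⟨ geodesics-share-first-edge (proj₁ girth) s+s<2s+2
                                                      (proj₂ (foot-level dx i di))
                                                      (prefix (through i di) s s≤1+s)
                                                      (prefix (through j dj) s s≤1+s) e ⟩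
    vertex (prefix (through j dj) s s≤1+s) 1     ≡⟨ vertex-prefix (through j dj) s s≤1+s 1 s≥1 ⟩
    vertex (through j dj) 1                      ≡⟨ vertex-start (proj₁ dj) ⟩
    β j                                          ∎)
    where
    open ≡-Reasoning
    s≤1+s : s ≤ suc s
    s≤1+s = n≤1+n s
    s+s<2s+2 : s + s < 2 * s + 2
    s+s<2s+2 = subst (λ a → s + s < s + a + 2) (sym (+-identityʳ s)) (m<m+n (s + s) (s≤s z≤n))

  -- at most c_s' indices j have d(β_j, x) = s when x ∈ Δ, by injectivity of the foot map
  few-at-distance-s : ∀ {x} → InΔ σ x → (B : Subset k) → (∀ j → j ∈ B → Dist Γ (β j) x s) → ∣ B ∣ ≤ c
  few-at-distance-s {x} x∈Δ B dB with c-def x x∈Δ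
  ... | A , members , ∣A∣≡c = subst (∣ B ∣ ≤_) ∣A∣≡c (injection-size B A
          (λ j p → foot j (dB j p))
          (λ j p → Equivalence.from (members _) (foot-adj j (dB j p) , foot-level (Δ-dist x∈Δ) j (dB j p)))
          (λ i j p q → foot-injective (Δ-dist x∈Δ) i j (dB i p) (dB j q)))

  determined-by : ∀ {S x} → ∣ S ∣ ≡ c → InΔS σ S x → ∀ j → Dist Γ (β j) x s → j ∈ S
  determined-by {S} {x} ∣S∣≡c (x∈Δ , dS) j dj with j ∈? S
  ... | yes j∈S = j∈S
  ... | no j∉S = ⊥-elim (<⇒≱ c<∣S+j∣ (few-at-distance-s x∈Δ (S ∪ ⁅ j ⁆) dS+j))
    where
    c<∣S+j∣ : c < ∣ S ∪ ⁅ j ⁆ ∣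
    c<∣S+j∣ = subst (_< ∣ S ∪ ⁅ j ⁆ ∣) ∣S∣≡c
                (p⊂q⇒∣p∣<∣q∣ (p⊆p∪q ⁅ j ⁆ , j , x∈p∪q⁺ (inj₂ (x∈⁅x⁆ j)) , j∉S))
    dS+j : ∀ i → i ∈ S ∪ ⁅ j ⁆ → Dist Γ (β i) x s
    dS+j i i∈ with x∈p∪q⁻ S ⁅ j ⁆ i∈
    ... | inj₁ i∈S = dS i i∈S
    ... | inj₂ i∈⁅j⁆ = subst (λ a → Dist Γ (β a) x s) (sym (x∈⁅y⁆⇒x≡y j i∈⁅j⁆)) dj

  disjoint : ∀ {S T} → ∣ S ∣ ≡ c → ∣ T ∣ ≡ c → S ≢ T → ∀ x → ¬ (InΔS σ S x × InΔS σ T x)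
  disjoint ∣S∣≡c ∣T∣≡c S≢T x (x∈ΔS , x∈ΔT) = S≢T (⊆-antisym
    (λ {j} j∈S → determined-by ∣T∣≡c x∈ΔT j (proj₂ x∈ΔS j j∈S))
    (λ {j} j∈T → determined-by ∣S∣≡c x∈ΔS j (proj₂ x∈ΔT j j∈T)))

  translate : ∀ {g S T w} (gSt : InStab σ g) → (∀ h → h ∈ T → ∃ λ j → j ∈ S × induced g gSt j ≡ h) →
              InΔS σ S w → InΔS σ T (to g w)
  translate {g} {S} {T} {w} gSt onto (w∈Δ , dS) = Δ-closed gSt w∈Δ , λ h h∈T → lift (onto h h∈T)
    where
    lift : ∀ {h} → (∃ λ j → j ∈ S × induced g gSt j ≡ h) → Dist Γ (β h) (to g w) s
    lift (j , j∈S , refl) = map-dist-β gSt (dS j j∈S)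

  correspondence : ∀ {S T x y g} → ∣ S ∣ ≡ c → ∣ T ∣ ≡ c → InΔS σ S x → InΔS σ T y →
    (gSt : InStab σ g) → to g x ≡ y →
    (∀ z → InΔS σ T z ⇔ (∃ λ w → InΔS σ S w × to g w ≡ z))
    ×
    (Σ (Fin k → Fin k) λ π →
      (∀ j → to g (β j) ≡ β (π j))
      × (∀ j → j ∈ S → π j ∈ T)
      × (∀ h → h ∈ T → ∃ λ j → j ∈ S × π j ≡ h)
      × (∀ i j → i ∈ S → j ∈ S → π i ≡ π j → i ≡ j))
  correspondence {S} {T} {x} {y} {g} ∣S∣≡c ∣T∣≡c x∈ΔS y∈ΔT gSt gx≡y =
    (λ z → mk⇔ (pull-back z) push-forward) ,
    π , induced-β g gSt , S→T , (λ h h∈T → π⁻¹ h , T→S h h∈T , induced-section g gSt h) ,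
    (λ i j _ _ → induced-injective g gSt i j)
    where
    π : Fin k → Fin k
    π = induced g gSt
    π⁻¹ : Fin k → Fin k
    π⁻¹ = induced (g ⁻¹) (stab-inverse gSt)
    g⁻¹y≡x : from g y ≡ x
    g⁻¹y≡x = trans (cong (from g) (sym gx≡y)) (from∘to g x)

    S→T : ∀ j → j ∈ S → π j ∈ T
    S→T j j∈S = determined-by ∣T∣≡c y∈ΔT (π j)
      (subst (λ a → Dist Γ (β (π j)) a s) gx≡y (map-dist-β gSt (proj₂ x∈ΔS j j∈S)))

    T→S : ∀ h → h ∈ T → π⁻¹ h ∈ S
    T→S h h∈T = determined-by ∣S∣≡c x∈ΔS (π⁻¹ h)
      (subst (λ a → Dist Γ (β (π⁻¹ h)) a s) g⁻¹y≡x (map-dist-β (stab-inverse gSt) (proj₂ y∈ΔT h h∈T)))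

    push-forward : ∀ {z} → (∃ λ w → InΔS σ S w × to g w ≡ z) → InΔS σ T z
    push-forward (w , w∈ΔS , refl) =
      translate gSt (λ h h∈T → π⁻¹ h , T→S h h∈T , induced-section g gSt h) w∈ΔS

    pull-back : ∀ z → InΔS σ T z → ∃ λ w → InΔS σ S w × to g w ≡ z
    pull-back z z∈ΔT = from g z ,
      translate (stab-inverse gSt) (λ j j∈S → π j , S→T j j∈S , induced-inverse g gSt j) z∈ΔT ,
      to∘from g z

lemma3p2 : ∀ {n k s t c : ℕ} (σ : Setting n k s t c) (S T : Subset k) →
    InB σ S → InB σ T →
    (S ≢ T → ∀ x → ¬ (InΔS σ S x × InΔS σ T x))
    ×
    (∀ x y (g : Perm n) → InΔS σ S x → InΔS σ T y → InStab σ g → to g x ≡ y →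
      (∀ z → InΔS σ T z ⇔ (∃ λ w → InΔS σ S w × to g w ≡ z))
      ×
      (Σ (Fin k → Fin k) λ π →
        (∀ j → to g (Setting.β σ j) ≡ Setting.β σ (π j))
        × (∀ j → j ∈ S → π j ∈ T)
        × (∀ h → h ∈ T → ∃ λ j → j ∈ S × π j ≡ h)
        × (∀ i j → i ∈ S → j ∈ S → π i ≡ π j → i ≡ j)))
lemma3p2 σ S T (∣S∣≡c , _) (∣T∣≡c , _) =
  disjoint ∣S∣≡c ∣T∣≡c ,
  λ x y g x∈ΔS y∈ΔT gSt gx≡y → correspondence ∣S∣≡c ∣T∣≡c x∈ΔS y∈ΔT gSt gx≡y
  where open InSetting σ
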